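{- For all integers $k\geq 4$ and $\ell\geq 1$, if $k$ is even or not divisible by $3$, then \[ f_2(k,\ell)\leq 2^\ell k^\ell(k+1)^\ell(k+2)^\ell. \]
   Context: A 2-coloring of a set $A\subseteq\mathbb{N}$ is a function $\Delta:A\to\{0,1\}$. For integers $r,k\geq 2$ and $\ell\geq 1$, $f_r(k,\ell)$ denotes the smallest positive integer $n$ such that every $r$-coloring $\Delta$ of $\{1,2,\ldots,n\}$ has a monochromatic solution to $1/x_1^{1/\ell}+\cdots+1/x_k^{1/\ell}=1/y^{1/\ell}$, i.e. elements $a_1,\ldots,a_k,b$ (with $a_1,\ldots,a_k$ not necessarily distinct) satisfying the equation and $\Delta(a_1)=\cdots=\Delta(a_k)=\Delta(b)$. -}

module Defs where

open import Level using (Level; _⊔_) renaming (suc to lsuc)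
open import Data.Nat using (ℕ; zero; suc; _≤_)
open import Data.Fin using (Fin)
import Data.Fin as Fin
open import Data.Bool using (Bool)
open import Data.Product using (Σ; Σ-syntax; _×_)
open import Relation.Nullary using (¬_)
open import Algebra.Bundles using (CommutativeRing)
open import Relation.Binary.Core using (Rel)
open import Relation.Binary.Structures using (IsStrictTotalOrder)
open import Relation.Binary.PropositionalEquality using (_≡_)

module RingOps {c r : Level} (R : CommutativeRing c r) where
  open CommutativeRing R
  pow : Carrier → ℕ → Carrier
  pow x zero    = 1#
  pow x (suc n) = x * pow x n
  fromℕ : ℕ → Carrier
  fromℕ zero    = 0#
  fromℕ (suc n) = 1# + fromℕ n
  sumFin : (k : ℕ) → (Fin k → Carrier) → Carrier
  sumFin zero    f = 0#
  sumFin (suc k) f = f Fin.zero + sumFin k (λ i → f (Fin.suc i))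

-- The
-- paper's equation lives in ℝ; agda-stdlib has no reals, so the theorem
-- quantifies over all such structures.
record OrderedFieldWithRoots (c r : Level) : Set (lsuc (c ⊔ r)) where
  field
    cring : CommutativeRing c r
  open CommutativeRing cring public
  open RingOps cring public
  field
    _<_            : Rel Carrier r
    isStrictTotal  : IsStrictTotalOrder _≈_ _<_
    0<1            : 0# < 1#
    +-mono-<       : ∀ {a b} z → a < b → (a + z) < (b + z)
    *-pos          : ∀ {a b} → 0# < a → 0# < b → 0# < (a * b)
    _⁻¹            : Carrier → Carrier
    ⁻¹-inverse     : ∀ x → ¬ (x ≈ 0#) → (x * (x ⁻¹)) ≈ 1#
    root           : ℕ → Carrier → Carrier
    root-pos       : ∀ ℓ x → 1 ≤ ℓ → 0# < x → 0# < root ℓ x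
    root-pow       : ∀ ℓ x → 1 ≤ ℓ → 0# < x → pow (root ℓ x) ℓ ≈ x

InRange : ℕ → ℕ → Set
InRange n a = 1 ≤ a × a ≤ n

RootEq : ∀ {c r} (F : OrderedFieldWithRoots c r) (k ℓ : ℕ) → (Fin k → ℕ) → ℕ → Set r
RootEq F k ℓ x y =
  sumFin k (λ i → (root ℓ (fromℕ (x i))) ⁻¹) ≈ (root ℓ (fromℕ y)) ⁻¹
  where open OrderedFieldWithRoots F

-- Every 2-coloring of {1,…,n} has a monochromatic solution
-- (a coloring of {1,…,n} is represented by any Δ : ℕ → Bool; only its
-- values on {1,…,n} matter).
Rado2 : ∀ {c r} (F : OrderedFieldWithRoots c r) (k ℓ n : ℕ) → Set r
Rado2 F k ℓ n =
  (Δ : ℕ → Bool) →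
  Σ[ a ∈ (Fin k → ℕ) ] Σ[ b ∈ ℕ ]
    ((∀ i → InRange n (a i)) × InRange n b ×
     (∀ i → Δ (a i) ≡ Δ b) × RootEq F k ℓ a b)

-- f₂(k,ℓ) ≤ m : since f₂(k,ℓ) is the LEAST n with Rado2, this holds iff
-- some n ≤ m has the property.
f₂≤ : ∀ {c r} (F : OrderedFieldWithRoots c r) (k ℓ m : ℕ) → Set r
f₂≤ F k ℓ m = Σ[ n ∈ ℕ ] (1 ≤ n × n ≤ m × Rado2 F k ℓ n)

-- Let M = 2k(k+1)(k+2) and, for a divisor u of M, let x = M/u.  A relation
-- u₁ + ⋯ + u_k = v between divisors of M turns into 1/x₁ + ⋯ + 1/x_k = 1/y, and
-- as the ℓ-th root of x^ℓ is x, the numbers x₁^ℓ, …, x_k^ℓ, y^ℓ ≤ M^ℓ solve the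
-- equation.  It therefore suffices to find divisors of M and relations among
-- them such that every 2-colouring of the divisors makes some relation
-- monochromatic.  Fifteen divisors (1, 2, 3, 4, k, 2k, k+2, …) and eighteen
-- relations of the form p·α + q·β + (k − p − q)·γ = τ do it, by a finite case
-- analysis on the colours.

module Submission where

open import Defs
open import Level using (Level)
open import Data.Empty using (⊥-elim)
open import Data.Fin using (Fin)
import Data.Fin as Fin
import Data.Nat as ℕ
open import Data.Nat using (ℕ; zero; suc; NonZero; ≢-nonZero⁻¹)
open import Data.Nat.Properties using (+-0-monoid; m^n≢0)
open import Algebra.Properties.Monoid.Sum +-0-monoid using (sum; sum-cong-≗)
open import Function using (_∘_)
open import Relation.Binary.Definitions using (tri<; tri≈; tri>)
open import Relation.Binary.PropositionalEquality using (_≡_)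
import Relation.Binary.PropositionalEquality as ≡
open import Relation.Binary.Structures using (IsStrictTotalOrder)
open import Relation.Nullary using (¬_; contradiction)

nonZero-factor : ∀ {L} t {w} → .{{NonZero L}} → L ≡ t ℕ.* w → NonZero t
nonZero-factor zero    L≡0 = contradiction L≡0 (≢-nonZero⁻¹ _)
nonZero-factor (suc t) _   = _

module RootEquation {c r : Level} (F : OrderedFieldWithRoots c r) where

  open OrderedFieldWithRoots F
  open IsStrictTotalOrder isStrictTotal using (compare; irrefl; <-respˡ-≈; <-respʳ-≈) renaming (trans to <-trans)
  open import Relation.Binary.Reasoning.Setoid setoid

  <⇒0<- : ∀ {a b} → a < b → 0# < (b - a)
  <⇒0<- {a} {b} a<b = <-respˡ-≈ (-‿inverseʳ a) (+-mono-< (- a) a<b)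

  *-monoʳ-< : ∀ {a b z} → 0# < z → a < b → (a * z) < (b * z)
  *-monoʳ-< {a} {b} {z} 0<z a<b =
    <-respˡ-≈ (+-identityˡ (a * z)) (<-respʳ-≈ b-a+a≈b (+-mono-< (a * z) (*-pos (<⇒0<- a<b) 0<z)))
    where
      b-a+a≈b : (b - a) * z + a * z ≈ b * z
      b-a+a≈b = begin
        (b - a) * z + a * z ≈⟨ distribʳ z (b - a) a ⟨
        (b - a + a) * z     ≈⟨ *-congʳ (+-assoc b (- a) a) ⟩
        (b + (- a + a)) * z ≈⟨ *-congʳ (+-congˡ (-‿inverseˡ a)) ⟩
        (b + 0#) * z        ≈⟨ *-congʳ (+-identityʳ b) ⟩
        b * z               ∎

  *-monoˡ-< : ∀ {a b z} → 0# < z → a < b → (z * a) < (z * b)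
  *-monoˡ-< {a} {b} {z} 0<z a<b = <-respˡ-≈ (*-comm a z) (<-respʳ-≈ (*-comm b z) (*-monoʳ-< 0<z a<b))

  pow-pos : ∀ {x} n → 0# < x → 0# < pow x n
  pow-pos zero    _   = 0<1
  pow-pos (suc n) 0<x = *-pos 0<x (pow-pos n 0<x)

  pow-mono-< : ∀ {x y} n → 0# < x → x < y → pow x (suc n) < pow y (suc n)
  pow-mono-< zero    0<x x<y = *-monoʳ-< 0<1 x<y
  pow-mono-< (suc n) 0<x x<y =
    <-trans (*-monoʳ-< (pow-pos (suc n) 0<x) x<y) (*-monoˡ-< (<-trans 0<x x<y) (pow-mono-< n 0<x x<y))

  pow-injective : ∀ {x y} ℓ → 1 ℕ.≤ ℓ → 0# < x → 0# < y → pow x ℓ ≈ pow y ℓ → x ≈ y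
  pow-injective {x} {y} (suc n) _ 0<x 0<y xⁿ≈yⁿ with compare x y
  ... | tri< x<y _ _ = ⊥-elim (irrefl xⁿ≈yⁿ (pow-mono-< n 0<x x<y))
  ... | tri≈ _ x≈y _ = x≈y
  ... | tri> _ _ y<x = ⊥-elim (irrefl (sym xⁿ≈yⁿ) (pow-mono-< n 0<y y<x))

  fromℕ-+ : ∀ m n → fromℕ (m ℕ.+ n) ≈ fromℕ m + fromℕ n
  fromℕ-+ zero    n = sym (+-identityˡ (fromℕ n))
  fromℕ-+ (suc m) n = trans (+-congˡ (fromℕ-+ m n)) (sym (+-assoc 1# (fromℕ m) (fromℕ n)))

  fromℕ-* : ∀ m n → fromℕ (m ℕ.* n) ≈ fromℕ m * fromℕ n
  fromℕ-* zero    n = sym (zeroˡ (fromℕ n))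
  fromℕ-* (suc m) n = begin
    fromℕ (n ℕ.+ m ℕ.* n)             ≈⟨ fromℕ-+ n (m ℕ.* n) ⟩
    fromℕ n + fromℕ (m ℕ.* n)         ≈⟨ +-cong (sym (*-identityˡ (fromℕ n))) (fromℕ-* m n) ⟩
    1# * fromℕ n + fromℕ m * fromℕ n  ≈⟨ distribʳ (fromℕ n) 1# (fromℕ m) ⟨
    (1# + fromℕ m) * fromℕ n          ∎

  fromℕ-^ : ∀ t n → fromℕ (t ℕ.^ n) ≈ pow (fromℕ t) n
  fromℕ-^ t zero    = +-identityʳ 1#
  fromℕ-^ t (suc n) = trans (fromℕ-* t (t ℕ.^ n)) (*-congˡ (fromℕ-^ t n))

  fromℕ-sum : ∀ {k} (u : Fin k → ℕ) → fromℕ (sum u) ≈ sumFin k (fromℕ ∘ u)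
  fromℕ-sum {zero}  u = refl
  fromℕ-sum {suc k} u = trans (fromℕ-+ (u Fin.zero) _) (+-congˡ (fromℕ-sum (u ∘ Fin.suc)))

  fromℕ-pos : ∀ n → .{{NonZero n}} → 0# < fromℕ n
  fromℕ-pos (suc zero)    = <-respʳ-≈ (sym (+-identityʳ 1#)) 0<1
  fromℕ-pos (suc (suc n)) =
    <-trans (<-respʳ-≈ (sym (+-identityˡ _)) (fromℕ-pos (suc n))) (+-mono-< (fromℕ (suc n)) 0<1)

  root-fromℕ-^ : ∀ ℓ t → 1 ℕ.≤ ℓ → .{{NonZero t}} → root ℓ (fromℕ (t ℕ.^ ℓ)) ≈ fromℕ t
  root-fromℕ-^ ℓ t 1≤ℓ = pow-injective ℓ 1≤ℓ (root-pos ℓ _ 1≤ℓ 0<t^ℓ) (fromℕ-pos t)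
    (trans (root-pow ℓ _ 1≤ℓ 0<t^ℓ) (fromℕ-^ t ℓ))
    where
      0<t^ℓ : 0# < fromℕ (t ℕ.^ ℓ)
      0<t^ℓ = fromℕ-pos (t ℕ.^ ℓ) {{m^n≢0 t ℓ}}

  sumFin-cong : ∀ k {f g : Fin k → Carrier} → (∀ i → f i ≈ g i) → sumFin k f ≈ sumFin k g
  sumFin-cong zero    f≈g = refl
  sumFin-cong (suc k) f≈g = +-cong (f≈g Fin.zero) (sumFin-cong k (f≈g ∘ Fin.suc))

  sumFin-*ʳ : ∀ k (f : Fin k → Carrier) z → sumFin k (λ i → f i * z) ≈ sumFin k f * z
  sumFin-*ʳ zero    f z = sym (zeroˡ z)
  sumFin-*ʳ (suc k) f z =
    trans (+-congˡ (sumFin-*ʳ k (f ∘ Fin.suc) z)) (sym (distribʳ z (f Fin.zero) (sumFin k (f ∘ Fin.suc))))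

  0<⇒≉0 : ∀ {x} → 0# < x → ¬ (x ≈ 0#)
  0<⇒≉0 0<x x≈0 = irrefl (sym x≈0) 0<x

  ⁻¹-unique : ∀ {x y} → ¬ (x ≈ 0#) → (x * y) ≈ 1# → y ≈ (x ⁻¹)
  ⁻¹-unique {x} {y} x≉0 xy≈1 = begin
    y                ≈⟨ *-identityʳ y ⟨
    y * 1#           ≈⟨ *-congˡ (⁻¹-inverse x x≉0) ⟨
    y * (x * x ⁻¹)   ≈⟨ *-assoc y x (x ⁻¹) ⟨
    (y * x) * x ⁻¹   ≈⟨ *-congʳ (trans (*-comm y x) xy≈1) ⟩
    1# * x ⁻¹        ≈⟨ *-identityˡ (x ⁻¹) ⟩
    x ⁻¹             ∎

  ⁻¹-cong : ∀ {x y} → ¬ (y ≈ 0#) → x ≈ y → (x ⁻¹) ≈ (y ⁻¹)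
  ⁻¹-cong y≉0 x≈y = ⁻¹-unique y≉0 (trans (*-congʳ (sym x≈y)) (⁻¹-inverse _ (y≉0 ∘ trans (sym x≈y))))

  fromℕ-⁻¹ : ∀ {L} t w → .{{NonZero L}} → L ≡ t ℕ.* w → (fromℕ t ⁻¹) ≈ (fromℕ w * fromℕ L ⁻¹)
  fromℕ-⁻¹ {L} t w L≡tw = sym (⁻¹-unique (0<⇒≉0 (fromℕ-pos t {{nonZero-factor t L≡tw}})) (begin
    fromℕ t * (fromℕ w * fromℕ L ⁻¹)  ≈⟨ *-assoc (fromℕ t) (fromℕ w) (fromℕ L ⁻¹) ⟨
    (fromℕ t * fromℕ w) * fromℕ L ⁻¹  ≈⟨ *-congʳ (fromℕ-* t w) ⟨
    fromℕ (t ℕ.* w) * fromℕ L ⁻¹      ≈⟨ *-congʳ (reflexive (≡.cong fromℕ (≡.sym L≡tw))) ⟩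
    fromℕ L * fromℕ L ⁻¹              ≈⟨ ⁻¹-inverse (fromℕ L) (0<⇒≉0 (fromℕ-pos L)) ⟩
    1#                                ∎))

  root-^-⁻¹ : ∀ ℓ {L} t w → 1 ℕ.≤ ℓ → .{{NonZero L}} → L ≡ t ℕ.* w →
              (root ℓ (fromℕ (t ℕ.^ ℓ)) ⁻¹) ≈ (fromℕ w * fromℕ L ⁻¹)
  root-^-⁻¹ ℓ t w 1≤ℓ L≡tw =
    trans (⁻¹-cong (0<⇒≉0 (fromℕ-pos t)) (root-fromℕ-^ ℓ t 1≤ℓ)) (fromℕ-⁻¹ t w L≡tw)
    where
      instance
        t≢0 : NonZero t
        t≢0 = nonZero-factor t L≡tw

  rootEq-of-common-multiple : ∀ {k} ℓ → 1 ℕ.≤ ℓ → (L : ℕ) → .{{NonZero L}} →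
    (x u : Fin k → ℕ) (y v : ℕ) → (∀ i → L ≡ x i ℕ.* u i) → L ≡ y ℕ.* v → sum u ≡ v →
    RootEq F k ℓ (λ i → x i ℕ.^ ℓ) (y ℕ.^ ℓ)
  rootEq-of-common-multiple {k} ℓ 1≤ℓ L x u y v L≡xu L≡yv Σu≡v = begin
    sumFin k (λ i → root ℓ (fromℕ (x i ℕ.^ ℓ)) ⁻¹)
      ≈⟨ sumFin-cong k (λ i → root-^-⁻¹ ℓ (x i) (u i) 1≤ℓ (L≡xu i)) ⟩
    sumFin k (λ i → fromℕ (u i) * fromℕ L ⁻¹)
      ≈⟨ sumFin-*ʳ k (fromℕ ∘ u) (fromℕ L ⁻¹) ⟩
    sumFin k (fromℕ ∘ u) * fromℕ L ⁻¹
      ≈⟨ *-congʳ (fromℕ-sum u) ⟨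
    fromℕ (sum u) * fromℕ L ⁻¹
      ≈⟨ *-congʳ (reflexive (≡.cong fromℕ Σu≡v)) ⟩
    fromℕ v * fromℕ L ⁻¹
      ≈⟨ root-^-⁻¹ ℓ y v 1≤ℓ L≡yv ⟨
    root ℓ (fromℕ (y ℕ.^ ℓ)) ⁻¹
      ∎

open import Data.Nat using (_≤_; _+_; _*_; _^_; z≤n; s≤s; >-nonZero⁻¹)
open import Data.Nat.Divisibility
  using (_∣_; _∣0; 1∣_; ∣-trans; ∣-reflexive; ∣m∣n⇒∣m+n; m∣m*n; n∣m*n; ∣m⇒∣m*n; *-monoˡ-∣; *-monoʳ-∣;
         quotient; quotient≢0; quotient-∣; m∣n⇒n≡quotient*m; ∣⇒≤)
open import Data.Nat.Properties using (*-commutativeSemigroup; +-assoc; *-assoc; ≤-reflexive; ^-monoˡ-≤)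
open import Data.Nat.Tactic.RingSolver using (solve-∀; solve)
open import Algebra.Properties.CommutativeSemigroup using (interchange)
open import Data.Bool using (Bool; true; false; not)
open import Data.Bool.Properties using (not-injective)
open import Data.List using (_∷_; [])
open import Data.Product using (Σ; Σ-syntax; _×_; _,_)
open import Data.Sum using (_⊎_)
open import Data.Sum.Properties using ([,]-map)
open import Data.Vec.Functional using (Vector; _++_; replicate)
open import Data.Vec.Functional.Relation.Unary.All.Properties using (++⁺)
open import Relation.Binary.PropositionalEquality
  using (refl; sym; trans; subst; cong; cong₂; module ≡-Reasoning)

sum-++ : ∀ {A : Set} {m n} (f : A → ℕ) (xs : Vector A m) (ys : Vector A n) →
         sum (f ∘ (xs ++ ys)) ≡ sum (f ∘ xs) + sum (f ∘ ys)
sum-++ {m = zero}  f xs ys = refl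
sum-++ {m = suc m} f xs ys = begin
  x₀ + sum (f ∘ (xs ++ ys) ∘ Fin.suc)          ≡⟨ cong (x₀ +_) (sum-cong-≗ (cong f ∘ [,]-map ∘ Fin.splitAt m)) ⟩
  x₀ + sum (f ∘ ((xs ∘ Fin.suc) ++ ys))        ≡⟨ cong (x₀ +_) (sum-++ f (xs ∘ Fin.suc) ys) ⟩
  x₀ + (sum (f ∘ xs ∘ Fin.suc) + sum (f ∘ ys)) ≡⟨ +-assoc x₀ _ _ ⟨
  sum (f ∘ xs) + sum (f ∘ ys)                  ∎
  where
    open ≡-Reasoning
    x₀ : ℕ
    x₀ = f (xs Fin.zero)

sum-replicate : ∀ n a → sum (replicate n a) ≡ n * a
sum-replicate zero    a = refl
sum-replicate (suc n) a = cong (a +_) (sum-replicate n a)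

^-distribʳ-* : ∀ m n o → (m * n) ^ o ≡ m ^ o * n ^ o
^-distribʳ-* m n zero    = refl
^-distribʳ-* m n (suc o) =
  trans (cong (m * n *_) (^-distribʳ-* m n o)) (interchange *-commutativeSemigroup m n (m ^ o) (n ^ o))

2∣n*[n+1] : ∀ n → 2 ∣ n * (n + 1)
2∣n*[n+1] zero    = 2 ∣0
2∣n*[n+1] (suc n) = subst (2 ∣_) step (∣m∣n⇒∣m+n (2∣n*[n+1] n) (m∣m*n (n + 1)))
  where
    step : n * (n + 1) + 2 * (n + 1) ≡ suc n * (suc n + 1)
    step = solve (n ∷ [])

3∣n*[n+1]*[n+2] : ∀ n → 3 ∣ n * (n + 1) * (n + 2)
3∣n*[n+1]*[n+2] zero    = 3 ∣0
3∣n*[n+1]*[n+2] (suc n) = subst (3 ∣_) step (∣m∣n⇒∣m+n (3∣n*[n+1]*[n+2] n) (m∣m*n ((n + 1) * (n + 2))))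
  where
    step : n * (n + 1) * (n + 2) + 3 * ((n + 1) * (n + 2)) ≡ suc n * (suc n + 1) * (suc n + 2)
    step = solve (n ∷ [])

data Node : Set where
  d1 d2 d3 d4 dk d2k db d2a d2b dka dkb dab d2ka d2kb dkab : Node

module Divisors (k : ℕ) where

  a b M : ℕ
  a = k + 1
  b = k + 2
  M = 2 * k * a * b

  u : Node → ℕ
  u d1   = 1
  u d2   = 2
  u d3   = 3
  u d4   = 4
  u dk   = k
  u d2k  = 2 * k
  u db   = b
  u d2a  = 2 * a
  u d2b  = 2 * b
  u dka  = k * a
  u dkb  = k * b
  u dab  = a * b
  u d2ka = 2 * k * a
  u d2kb = 2 * k * b
  u dkab = k * a * b

  u∣M : ∀ d → u d ∣ M
  u∣M d1   = 1∣ M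
  u∣M d2   = ∣m⇒∣m*n b (∣m⇒∣m*n a (m∣m*n {2} k))
  u∣M d3   = ∣-trans (3∣n*[n+1]*[n+2] k) (u∣M dkab)
  u∣M d4   = ∣m⇒∣m*n b (∣-trans (*-monoʳ-∣ 2 (2∣n*[n+1] k)) (∣-reflexive (sym (*-assoc 2 k a))))
  u∣M dk   = ∣m⇒∣m*n b (∣m⇒∣m*n a (n∣m*n 2 {k}))
  u∣M d2k  = ∣m⇒∣m*n b (m∣m*n a)
  u∣M db   = n∣m*n (2 * k * a)
  u∣M d2a  = ∣m⇒∣m*n b (*-monoˡ-∣ a (m∣m*n {2} k))
  u∣M d2b  = *-monoˡ-∣ b (∣m⇒∣m*n a (m∣m*n {2} k))
  u∣M dka  = ∣m⇒∣m*n b (*-monoˡ-∣ a (n∣m*n 2 {k}))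
  u∣M dkb  = *-monoˡ-∣ b (∣m⇒∣m*n a (n∣m*n 2 {k}))
  u∣M dab  = *-monoˡ-∣ b (n∣m*n (2 * k))
  u∣M d2ka = m∣m*n b
  u∣M d2kb = *-monoˡ-∣ b (m∣m*n {2 * k} a)
  u∣M dkab = *-monoˡ-∣ b (*-monoˡ-∣ a (n∣m*n 2 {k}))

  M^ℓ≡bound : ∀ ℓ → M ^ ℓ ≡ 2 ^ ℓ * k ^ ℓ * a ^ ℓ * b ^ ℓ
  M^ℓ≡bound ℓ = begin
    (2 * k * a * b) ^ ℓ             ≡⟨ ^-distribʳ-* (2 * k * a) b ℓ ⟩
    (2 * k * a) ^ ℓ * b ^ ℓ         ≡⟨ cong (_* b ^ ℓ) (^-distribʳ-* (2 * k) a ℓ) ⟩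
    (2 * k) ^ ℓ * a ^ ℓ * b ^ ℓ     ≡⟨ cong (λ z → z * a ^ ℓ * b ^ ℓ) (^-distribʳ-* 2 k ℓ) ⟩
    2 ^ ℓ * k ^ ℓ * a ^ ℓ * b ^ ℓ   ∎
    where open ≡-Reasoning

data Family : Set where
  f1 f2 f3 f4 f5 f6 f7 f8 f9 f10 f11 f12 f13 f14 f15 f16 f17 f18 : Family

record Shape : Set where
  constructor _,_,_⇒_
  field
    α β γ τ : Node

open Shape

shape : Family → Shape
shape f1  = d2   , dka  , d1   ⇒ dkb
shape f2  = d4   , db   , d1   ⇒ d2b
shape f3  = d4   , dkb  , d1   ⇒ dab
shape f4  = d4   , d2ka , d2   ⇒ d2kb
shape f5  = d3   , d3   , d2   ⇒ d2b
shape f6  = d3   , d3   , d1   ⇒ db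
shape f7  = d4   , d4   , d2   ⇒ d2a
shape f8  = d2   , d2   , db   ⇒ dka
shape f9  = d4   , d4   , d2b  ⇒ d2ka
shape f10 = d2k  , d2k  , dk   ⇒ dka
shape f11 = dab  , dab  , db   ⇒ d2kb
shape f12 = d2kb , d2kb , dkb  ⇒ dkab
shape f13 = d1   , d1   , d1   ⇒ dk
shape f14 = d2   , d2   , d2   ⇒ d2k
shape f15 = db   , db   , db   ⇒ dkb
shape f16 = d2a  , d2a  , d2a  ⇒ d2ka
shape f17 = d2b  , d2b  , d2b  ⇒ d2kb
shape f18 = dab  , dab  , dab  ⇒ dkab

Monochromatic : (Node → Bool) → Shape → Set
Monochromatic c s = c (α s) ≡ c (τ s) × c (β s) ≡ c (τ s) × c (γ s) ≡ c (τ s)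

MonochromaticFamily : (Node → Bool) → Set
MonochromaticFamily c = Σ Family (Monochromatic c ∘ shape)

cases : {X : Set} (b : Bool) → (b ≡ false → X) → (b ≡ true → X) → X
cases false f t = f refl
cases true  f t = t refl

module _ (c : Node → Bool) where

  found : ∀ {b} f → let s = shape f in
          c (α s) ≡ b → c (β s) ≡ b → c (γ s) ≡ b → c (τ s) ≡ b → MonochromaticFamily c
  found f eα eβ eγ eτ = f , trans eα (sym eτ) , trans eβ (sym eτ) , trans eγ (sym eτ)

  case-4-kb-2kb-as-1 : c d1 ≡ false → c d4 ≡ false → c dkb ≡ false → c d2kb ≡ false → MonochromaticFamily c
  case-4-kb-2kb-as-1 e1 e4 ekb e2kb =
    cases (c dab) (λ eab → found f3 e4 ekb e1 eab) λ eab →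
    cases (c dkab) (λ ekab → found f12 e2kb e2kb ekb ekab) λ ekab →
    found f18 eab eab eab ekab

  case-2a-as-1 : c d1 ≡ false → c d2 ≡ true → c d2a ≡ false → MonochromaticFamily c
  case-2a-as-1 e1 e2 e2a =
    cases (c d2ka) (λ e2ka → found f16 e2a e2a e2a e2ka) λ e2ka →
    cases (c d2b)
      (λ e2b →
        cases (c d2kb) (λ e2kb → found f17 e2b e2b e2b e2kb) λ e2kb →
        cases (c d4)
          (λ e4 →
            cases (c db) (λ eb → found f2 e4 eb e1 e2b) λ eb →
            cases (c dab)
              (λ eab → cases (c dkb) (λ ekb → found f3 e4 ekb e1 eab) λ ekb → found f15 eb eb eb ekb)
              (λ eab → found f11 eab eab eb e2kb))
          (λ e4 → found f4 e4 e2ka e2 e2kb))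
      (λ e2b →
        cases (c d3)
          (λ e3 →
            cases (c db) (λ eb → found f6 e3 e3 e1 eb) λ eb →
            cases (c d4)
              (λ e4 →
                cases (c dkb)
                  (λ ekb → cases (c d2kb) (case-4-kb-2kb-as-1 e1 e4 ekb) λ e2kb → found f17 e2b e2b e2b e2kb)
                  (λ ekb → found f15 eb eb eb ekb))
              (λ e4 → found f9 e4 e4 e2b e2ka))
          (λ e3 → found f5 e3 e3 e2 e2b))

  case-2a-as-2 : c d1 ≡ false → c d2 ≡ true → c d2a ≡ true → MonochromaticFamily c
  case-2a-as-2 e1 e2 e2a =
    cases (c d4)
      (λ e4 →
        cases (c d2ka)
          (λ e2ka →
            cases (c d2b) (λ e2b → found f9 e4 e4 e2b e2ka) λ e2b →
            cases (c d2kb)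
              (λ e2kb →
                cases (c d3)
                  (λ e3 →
                    cases (c db) (λ eb → found f6 e3 e3 e1 eb) λ eb →
                    cases (c dkb) (λ ekb → case-4-kb-2kb-as-1 e1 e4 ekb e2kb) λ ekb →
                    found f15 eb eb eb ekb)
                  (λ e3 → found f5 e3 e3 e2 e2b))
              (λ e2kb → found f17 e2b e2b e2b e2kb))
          (λ e2ka → found f16 e2a e2a e2a e2ka))
      (λ e4 → found f7 e4 e4 e2 e2a)

  monochromatic-family-1↦false : c d1 ≡ false → MonochromaticFamily c
  monochromatic-family-1↦false e1 =
    cases (c dk) (λ ek → found f13 e1 e1 e1 ek) λ ek →
    cases (c d2)
      (λ e2 →
        cases (c d2k) (λ e2k → found f14 e2 e2 e2 e2k) λ e2k →
        cases (c dka)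
          (λ eka →
            cases (c dkb) (λ ekb → found f1 e2 eka e1 ekb) λ ekb →
            cases (c db) (λ eb → found f8 e2 e2 eb eka) λ eb →
            found f15 eb eb eb ekb)
          (λ eka → found f10 e2k e2k ek eka))
      (λ e2 →
        cases (c d2k) (λ e2k → cases (c d2a) (case-2a-as-1 e1 e2) (case-2a-as-2 e1 e2)) λ e2k →
        found f14 e2 e2 e2 e2k)

monochromatic-family : ∀ c → MonochromaticFamily c
monochromatic-family c = cases (c d1) (monochromatic-family-1↦false c) λ e1 →
  let f , eα , eβ , eγ = monochromatic-family-1↦false (not ∘ c) (cong not e1)
  in f , not-injective eα , not-injective eβ , not-injective eγ

-- relation-fi m is p·u(α) + q·u(β) + r·u(γ) = u(τ) for k = 4 + m, where
-- (α , β , γ ⇒ τ) = shape fi and p + q + r = k.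
relation-f1 : ∀ m → let k = 4 + m; a = k + 1; b = k + 2 in
  1 * 2 + 1 * (k * a) + (2 + m) * 1 ≡ k * b
relation-f1 = solve-∀

relation-f2 : ∀ m → let k = 4 + m; a = k + 1; b = k + 2 in
  1 * 4 + 1 * b + (2 + m) * 1 ≡ 2 * b
relation-f2 = solve-∀

relation-f3 : ∀ m → let k = 4 + m; a = k + 1; b = k + 2 in
  1 * 4 + 1 * (k * b) + (2 + m) * 1 ≡ a * b
relation-f3 = solve-∀

relation-f4 : ∀ m → let k = 4 + m; a = k + 1; b = k + 2 in
  1 * 4 + 1 * (2 * k * a) + (2 + m) * 2 ≡ 2 * k * b
relation-f4 = solve-∀

relation-f5 : ∀ m → let k = 4 + m; a = k + 1; b = k + 2 in
  4 * 3 + 0 * 3 + m * 2 ≡ 2 * b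
relation-f5 = solve-∀

relation-f6 : ∀ m → let k = 4 + m; a = k + 1; b = k + 2 in
  1 * 3 + 0 * 3 + (3 + m) * 1 ≡ b
relation-f6 = solve-∀

relation-f7 : ∀ m → let k = 4 + m; a = k + 1; b = k + 2 in
  1 * 4 + 0 * 4 + (3 + m) * 2 ≡ 2 * a
relation-f7 = solve-∀

relation-f8 : ∀ m → let k = 4 + m; a = k + 1; b = k + 2 in
  1 * 2 + 0 * 2 + (3 + m) * b ≡ k * a
relation-f8 = solve-∀

relation-f9 : ∀ m → let k = 4 + m; a = k + 1; b = k + 2 in
  1 * 4 + 0 * 4 + (3 + m) * (2 * b) ≡ 2 * k * a
relation-f9 = solve-∀

relation-f10 : ∀ m → let k = 4 + m; a = k + 1; b = k + 2 in
  1 * (2 * k) + 0 * (2 * k) + (3 + m) * k ≡ k * a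
relation-f10 = solve-∀

relation-f11 : ∀ m → let k = 4 + m; a = k + 1; b = k + 2 in
  1 * (a * b) + 0 * (a * b) + (3 + m) * b ≡ 2 * k * b
relation-f11 = solve-∀

relation-f12 : ∀ m → let k = 4 + m; a = k + 1; b = k + 2 in
  1 * (2 * k * b) + 0 * (2 * k * b) + (3 + m) * (k * b) ≡ k * a * b
relation-f12 = solve-∀

relation-f13 : ∀ m → let k = 4 + m; a = k + 1; b = k + 2 in
  0 * 1 + 0 * 1 + (4 + m) * 1 ≡ k
relation-f13 = solve-∀

relation-f14 : ∀ m → let k = 4 + m; a = k + 1; b = k + 2 in
  0 * 2 + 0 * 2 + (4 + m) * 2 ≡ 2 * k
relation-f14 = solve-∀

relation-f15 : ∀ m → let k = 4 + m; a = k + 1; b = k + 2 in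
  0 * b + 0 * b + (4 + m) * b ≡ k * b
relation-f15 = solve-∀

relation-f16 : ∀ m → let k = 4 + m; a = k + 1; b = k + 2 in
  0 * (2 * a) + 0 * (2 * a) + (4 + m) * (2 * a) ≡ 2 * k * a
relation-f16 = solve-∀

relation-f17 : ∀ m → let k = 4 + m; a = k + 1; b = k + 2 in
  0 * (2 * b) + 0 * (2 * b) + (4 + m) * (2 * b) ≡ 2 * k * b
relation-f17 = solve-∀

relation-f18 : ∀ m → let k = 4 + m; a = k + 1; b = k + 2 in
  0 * (a * b) + 0 * (a * b) + (4 + m) * (a * b) ≡ k * a * b
relation-f18 = solve-∀

MonochromaticSolution : ∀ {c r} (F : OrderedFieldWithRoots c r) (k ℓ n : ℕ) → (ℕ → Bool) → Set r
MonochromaticSolution F k ℓ n Δ = Σ[ a ∈ (Fin k → ℕ) ] Σ[ b ∈ ℕ ]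
  ((∀ i → InRange n (a i)) × InRange n b × (∀ i → Δ (a i) ≡ Δ b) × RootEq F k ℓ a b)

module Construction {c₁ c₂} (F : OrderedFieldWithRoots c₁ c₂) (m ℓ : ℕ) (1≤ℓ : 1 ≤ ℓ) where

  open RootEquation F using (rootEq-of-common-multiple)
  open Divisors (4 + m) public

  x : Node → ℕ
  x d = quotient (u∣M d)

  x≢0 : ∀ d → NonZero (x d)
  x≢0 d = quotient≢0 (u∣M d)

  1≤^ℓ : ∀ n → .{{NonZero n}} → 1 ≤ n ^ ℓ
  1≤^ℓ n = >-nonZero⁻¹ (n ^ ℓ) {{m^n≢0 n ℓ}}

  x^ℓ∈range : ∀ d → InRange (M ^ ℓ) (x d ^ ℓ)
  x^ℓ∈range d = 1≤^ℓ (x d) {{x≢0 d}} , ^-monoˡ-≤ ℓ (∣⇒≤ (quotient-∣ (u∣M d)))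

  colour : (ℕ → Bool) → Node → Bool
  colour Δ d = Δ (x d ^ ℓ)

  solution : ∀ Δ (p q r : ℕ) (s : Shape) → p * u (α s) + q * u (β s) + r * u (γ s) ≡ u (τ s) →
             Monochromatic (colour Δ) s → MonochromaticSolution F (p + (q + r)) ℓ (M ^ ℓ) Δ
  solution Δ p q r (α , β , γ ⇒ τ) balanced (eα , eβ , eγ) =
      (λ i → x (summands i) ^ ℓ) , x τ ^ ℓ
    , x^ℓ∈range ∘ summands , x^ℓ∈range τ
    , ++⁺ P {xs = replicate p α} (λ _ → eα) (++⁺ P {xs = replicate q β} (λ _ → eβ) (λ _ → eγ))
    , rootEq-of-common-multiple ℓ 1≤ℓ M (x ∘ summands) (u ∘ summands) (x τ) (u τ)
        (m∣n⇒n≡quotient*m ∘ u∣M ∘ summands) (m∣n⇒n≡quotient*m (u∣M τ)) (trans sum-summands balanced)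
    where
      P : Node → Set
      P d = colour Δ d ≡ colour Δ τ
      summands : Vector Node (p + (q + r))
      summands = replicate p α ++ (replicate q β ++ replicate r γ)
      sum-summands : sum (u ∘ summands) ≡ p * u α + q * u β + r * u γ
      sum-summands = begin
        sum (u ∘ summands)
          ≡⟨ sum-++ u (replicate p α) (replicate q β ++ replicate r γ) ⟩
        sum (replicate p (u α)) + sum (u ∘ (replicate q β ++ replicate r γ))
          ≡⟨ cong₂ _+_ (sum-replicate p (u α)) (sum-++ u (replicate q β) (replicate r γ)) ⟩
        p * u α + (sum (replicate q (u β)) + sum (replicate r (u γ)))
          ≡⟨ cong (p * u α +_) (cong₂ _+_ (sum-replicate q (u β)) (sum-replicate r (u γ))) ⟩
        p * u α + (q * u β + r * u γ)
          ≡⟨ +-assoc (p * u α) (q * u β) (r * u γ) ⟨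
        p * u α + q * u β + r * u γ
          ∎
        where open ≡-Reasoning

  solution-for : ∀ Δ f → Monochromatic (colour Δ) (shape f) → MonochromaticSolution F (4 + m) ℓ (M ^ ℓ) Δ
  solution-for Δ f1  = solution Δ 1 1 (2 + m) (shape f1) (relation-f1 m)
  solution-for Δ f2  = solution Δ 1 1 (2 + m) (shape f2) (relation-f2 m)
  solution-for Δ f3  = solution Δ 1 1 (2 + m) (shape f3) (relation-f3 m)
  solution-for Δ f4  = solution Δ 1 1 (2 + m) (shape f4) (relation-f4 m)
  solution-for Δ f5  = solution Δ 4 0 m (shape f5) (relation-f5 m)
  solution-for Δ f6  = solution Δ 1 0 (3 + m) (shape f6) (relation-f6 m)
  solution-for Δ f7  = solution Δ 1 0 (3 + m) (shape f7) (relation-f7 m)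
  solution-for Δ f8  = solution Δ 1 0 (3 + m) (shape f8) (relation-f8 m)
  solution-for Δ f9  = solution Δ 1 0 (3 + m) (shape f9) (relation-f9 m)
  solution-for Δ f10 = solution Δ 1 0 (3 + m) (shape f10) (relation-f10 m)
  solution-for Δ f11 = solution Δ 1 0 (3 + m) (shape f11) (relation-f11 m)
  solution-for Δ f12 = solution Δ 1 0 (3 + m) (shape f12) (relation-f12 m)
  solution-for Δ f13 = solution Δ 0 0 (4 + m) (shape f13) (relation-f13 m)
  solution-for Δ f14 = solution Δ 0 0 (4 + m) (shape f14) (relation-f14 m)
  solution-for Δ f15 = solution Δ 0 0 (4 + m) (shape f15) (relation-f15 m)
  solution-for Δ f16 = solution Δ 0 0 (4 + m) (shape f16) (relation-f16 m)
  solution-for Δ f17 = solution Δ 0 0 (4 + m) (shape f17) (relation-f17 m)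
  solution-for Δ f18 = solution Δ 0 0 (4 + m) (shape f18) (relation-f18 m)

theorem4p3 : ∀ {c r : Level} (F : OrderedFieldWithRoots c r) (k ℓ : ℕ) →
    4 ≤ k → 1 ≤ ℓ → (2 ∣ k ⊎ ¬ (3 ∣ k)) →
    f₂≤ F k ℓ (2 ^ ℓ * k ^ ℓ * (k + 1) ^ ℓ * (k + 2) ^ ℓ)
theorem4p3 F (suc (suc (suc (suc m)))) ℓ (s≤s (s≤s (s≤s (s≤s z≤n)))) 1≤ℓ _ =
  M ^ ℓ , 1≤^ℓ M , ≤-reflexive (M^ℓ≡bound ℓ) ,
  λ Δ → let f , monochromatic = monochromatic-family (colour Δ) in solution-for Δ f monochromatic
  where open Construction F m ℓ 1≤ℓ
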